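{- A countable $\{\mathrm{D},\mathrm{R},*\}$-structure $\mathcal{S}$ is representable (i.e. belongs to $R(\mathrm{D},\mathrm{R},*)$) if and only if player $\exists$ has a winning strategy for the game $\Gamma_\omega(\mathcal{S})$.
   Context: Relational operations on $X$: $\mathrm{D}(R)=\{(x,x)\mid\exists y\,(x,y)\in R\}$, $\mathrm{R}(R)=\{(y,y)\mid\exists x\,(x,y)\in R\}$, $R;S=\{(x,z)\mid\exists y\,((x,y)\in R\wedge(y,z)\in S)\}$, demonic composition $R*S=\{(x,y)\in R;S\mid\forall z\,((x,z)\in R\Rightarrow(z,z)\in\mathrm{D}(S))\}$. A $\{\mathrm{D},\mathrm{R},*\}$-structure is representable if it is isomorphic to a set of binary relations on some base $X$ closed under $\mathrm{D},\mathrm{R},*$ with the relational interpretations. Networks. For a $\{\mathrm{D},\mathrm{R},*\}$-structure $\mathcal{S}$, a network is $\mathcal{N}=(N,\bot,\top)$ with $N$ a set of nodes and $\bot,\top:N\times N\to\wp(\mathcal{S})$. It is consistent iff (i) $\top(x,y)\cap\bot(x,y)=\emptyset$ for all $x,y\in N$, and (ii) whenever $s\in\top(x,y)$ and $s=\mathrm{D}(t)$ or $s=\mathrm{R}(t)$ for some $t\in\mathcal{S}$, then $x=y$. A network $(N',\bot',\top')$ extends $(N,\bot,\top)$ if $N\subseteq N'$ and $\top(x,y)\subseteq\top'(x,y)$, $\bot(x,y)\subseteq\bot'(x,y)$ for all $x,y\in N$. "Adding $a$ to $\top(x,y)$" means forming the network with node set $N\cup\{x,y\}$ in which $a$ is added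 to the $\top$-label of $(x,y)$ (labels not previously defined being $\emptyset$); similarly for $\bot$. Whenever $\exists$ "picks a node" she may pick an existing node of $N$ or a fresh node $x_+\notin N$. For $a,b\in\mathcal{S}$, $\mathcal{N}_{ref}[a,b]$ has a single node $x$ with $\top(x,x)=\{a\}$, $\bot(x,x)=\{b\}$; $\mathcal{N}_{nref}[a,b]$ has two nodes $x\ne y$ with $\top(x,y)=\{a\}$, $\bot(x,y)=\{b\}$; all other labels empty. The game $\Gamma_n(\mathcal{S})$ ($0<n\le\omega$) between $\forall$ and $\exists$: in the initialisation move $\forall$ picks $a\neq b$ in $\mathcal{S}$ and $\exists$ returns a network $\mathcal{N}_0$ extending one of $\mathcal{N}_{ref}[a,b],\mathcal{N}_{nref}[a,b],\mathcal{N}_{ref}[b,a],\mathcal{N}_{nref}[b,a]$. Then for $n$ further moves, given current $\mathcal{N}_k$, $\forall$ chooses one of the following and $\exists$ returns $\mathcal{N}_{k+1}$ extending $\mathcal{N}_k$ as described: (Witness) $\forall$ picks $x,z$ and $a,b$ with $a*b\in\top(x,z)$; $\exists$ picks a node $y$ and returns an extension of the network obtained by adding $a$ to $\top(x,y)$ and $b$ to $\top(y,z)$. (Composition-domain) $\forall$ picks $x,y,z,a,b$ with $a\in\top(x,y)$, $a*b\in\top(x,z)$; $\exists$ returns an extension with $\mathrm{D}(b)$ added to $\top(y,y)$. (Composition) $\forall$ picks $x,y,z,a,b$ with $a\in\top(x,y)$, $b\in\top(y,z)$; $\exists$ either returns an extension with $a*b$ added to $\top(x,z)$, or picks a node $w$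 and returns an extension with $a$ added to $\top(x,w)$ and $\mathrm{D}(b)$ added to $\bot(w,w)$. (Domain-range) $\forall$ picks $x,y,a$ with $a\in\top(x,y)$; $\exists$ returns an extension with $\mathrm{D}(a)$ added to $\top(x,x)$ and $\mathrm{R}(a)$ added to $\top(y,y)$. (Domain) $\forall$ picks $x,a$ with $\mathrm{D}(a)\in\top(x,x)$; $\exists$ picks a node $y$ and returns an extension with $a$ added to $\top(x,y)$. (Range) $\forall$ picks $y,a$ with $\mathrm{R}(a)\in\top(y,y)$; $\exists$ picks a node $x$ and returns an extension with $a$ added to $\top(x,y)$. $\forall$ wins a play iff $\exists$ at some point returns an inconsistent network; otherwise $\exists$ wins. -}

module Defs where

open import Level using (0ℓ; suc)
open import Data.Nat using (ℕ; zero; suc)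
open import Data.Product using (Σ; Σ-syntax; _×_; _,_)
open import Data.Sum using (_⊎_)
open import Data.Empty using (⊥)
open import Relation.Nullary using (¬_)
open import Relation.Binary.PropositionalEquality using (_≡_)
open import Function.Bundles using (_⇔_)

record DRStar : Set₁ where
  field
    Carrier : Set
    D   : Carrier → Carrier
    R   : Carrier → Carrier
    _*_ : Carrier → Carrier → Carrier

-- countable: injects into ℕ (covers finite, including empty, structures)
Countable : DRStar → Set
Countable S = Σ[ f ∈ (DRStar.Carrier S → ℕ) ] (∀ a b → f a ≡ f b → a ≡ b)

BRel : Set → Set₁
BRel X = X → X → Set

_≐_ : {X : Set} → BRel X → BRel X → Set
_≐_ {X} P Q = ∀ (x y : X) → P x y ⇔ Q x y

Dʳ : {X : Set} → BRel X → BRel X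
Dʳ P x x' = (x ≡ x') × Σ[ y ∈ _ ] P x y

Rʳ : {X : Set} → BRel X → BRel X
Rʳ P y y' = (y ≡ y') × Σ[ x ∈ _ ] P x y

_⨾_ : {X : Set} → BRel X → BRel X → BRel X
(P ⨾ Q) x z = Σ[ y ∈ _ ] (P x y × Q y z)

_⊛_ : {X : Set} → BRel X → BRel X → BRel X
(P ⊛ Q) x y = (P ⨾ Q) x y × (∀ z → P x z → Dʳ Q z z)

-- S is isomorphic to a set of binary relations on some base X closed under
-- D, R, * (i.e. there is an injective homomorphism into the relations on X;
-- its image is then automatically closed under the operations).
Representable : DRStar → Set₁
Representable S =
  Σ[ X ∈ Set ] Σ[ θ ∈ (Carrier → BRel X) ]
    ((∀ a b → θ a ≐ θ b → a ≡ b)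
   × (∀ a → θ (D a) ≐ Dʳ (θ a))
   × (∀ a → θ (R a) ≐ Rʳ (θ a))
   × (∀ a b → θ (a * b) ≐ (θ a ⊛ θ b)))
  where open DRStar S

module Game (S : DRStar) where
  open DRStar S

  -- nodes are drawn from ℕ; `node` says which belong to N.
  -- top/bot labels only count on pairs of nodes (see _∈⊤ and _∈⊥ below).
  record Network : Set₁ where
    field
      node : ℕ → Set
      top  : ℕ → ℕ → Carrier → Set
      bot  : ℕ → ℕ → Carrier → Set
  open Network public

  InTop : Network → ℕ → ℕ → Carrier → Set
  InTop N x y c = node N x × node N y × top N x y c

  InBot : Network → ℕ → ℕ → Carrier → Set
  InBot N x y c = node N x × node N y × bot N x y c

  Consistent : Network → Set
  Consistent N =
    (∀ x y c → InTop N x y c → InBot N x y c → ⊥)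
    × (∀ x y s → InTop N x y s → (Σ[ t ∈ Carrier ] (s ≡ D t ⊎ s ≡ R t)) → x ≡ y)

  Extends : Network → Network → Set
  Extends N N' =
    (∀ x → node N x → node N' x)
    × (∀ x y c → InTop N x y c → InTop N' x y c)
    × (∀ x y c → InBot N x y c → InBot N' x y c)

  addTop : Network → ℕ → ℕ → Carrier → Network
  addTop N x y a = record
    { node = λ v → node N v ⊎ (v ≡ x ⊎ v ≡ y)
    ; top  = λ u v c → InTop N u v c ⊎ (u ≡ x × v ≡ y × c ≡ a)
    ; bot  = λ u v c → InBot N u v c }

  addBot : Network → ℕ → ℕ → Carrier → Network
  addBot N x y a = record
    { node = λ v → node N v ⊎ (v ≡ x ⊎ v ≡ y)
    ; top  = λ u v c → InTop N u v c
    ; bot  = λ u v c → InBot N u v c ⊎ (u ≡ x × v ≡ y × c ≡ a) }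

  Nref : Carrier → Carrier → Network
  Nref a b = record
    { node = λ v → v ≡ 0
    ; top  = λ u v c → u ≡ 0 × v ≡ 0 × c ≡ a
    ; bot  = λ u v c → u ≡ 0 × v ≡ 0 × c ≡ b }

  Nnref : Carrier → Carrier → Network
  Nnref a b = record
    { node = λ v → v ≡ 0 ⊎ v ≡ 1
    ; top  = λ u v c → u ≡ 0 × v ≡ 1 × c ≡ a
    ; bot  = λ u v c → u ≡ 0 × v ≡ 1 × c ≡ b }

  data Move (N : Network) : Set where
    witness   : (x z : ℕ) (a b : Carrier) → InTop N x z (a * b) → Move N
    compDom   : (x y z : ℕ) (a b : Carrier) →
                InTop N x y a → InTop N x z (a * b) → Move N
    comp      : (x y z : ℕ) (a b : Carrier) →
                InTop N x y a → InTop N y z b → Move N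
    domRange  : (x y : ℕ) (a : Carrier) → InTop N x y a → Move N
    domain    : (x : ℕ) (a : Carrier) → InTop N x x (D a) → Move N
    range     : (y : ℕ) (a : Carrier) → InTop N y y (R a) → Move N

  -- legal responses N' of ∃ to a move (before the consistency requirement);
  -- "∃ picks a node" = she picks any y : ℕ (an existing node or a fresh one)
  Response : (N : Network) → Move N → Network → Set
  Response N (witness x z a b _) N' =
    Σ[ y ∈ ℕ ] Extends (addTop (addTop N x y a) y z b) N'
  Response N (compDom x y z a b _ _) N' =
    Extends (addTop N y y (D b)) N'
  Response N (comp x y z a b _ _) N' =
    Extends (addTop N x z (a * b)) N'
    ⊎ (Σ[ w ∈ ℕ ] Extends (addBot (addTop N x w a) w w (D b)) N')
  Response N (domRange x y a _) N' =
    Extends (addTop (addTop N x x (D a)) y y (R a)) N'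
  Response N (domain x a _) N' =
    Σ[ y ∈ ℕ ] Extends (addTop N x y a) N'
  Response N (range y a _) N' =
    Σ[ x ∈ ℕ ] Extends (addTop N x y a) N'

  data Hist (N₀ : Network) : Network → Set₁ where
    start : Hist N₀ N₀
    step  : {N : Network} → Hist N₀ N → (m : Move N) → (N' : Network) →
            Hist N₀ N'

  Strategy : Network → Set₁
  Strategy N₀ = {N : Network} → Hist N₀ N → Move N → Network

  data Conform {N₀ : Network} (σ : Strategy N₀) :
               {N : Network} → Hist N₀ N → Set₁ where
    start : Conform σ start
    step  : {N : Network} {h : Hist N₀ N} → Conform σ h → (m : Move N) →
            Conform σ (step h m (σ h m))

  Winning : (N₀ : Network) → Strategy N₀ → Set₁
  Winning N₀ σ =
    {N : Network} (h : Hist N₀ N) → Conform σ h → (m : Move N) →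
    Response N m (σ h m) × Consistent (σ h m)

  ∃WinsΓω : Set₁
  ∃WinsΓω =
    (a b : Carrier) → ¬ (a ≡ b) →
    Σ[ N₀ ∈ Network ]
      ((Extends (Nref a b) N₀ ⊎ Extends (Nnref a b) N₀
        ⊎ Extends (Nref b a) N₀ ⊎ Extends (Nnref b a) N₀)
       × Consistent N₀ × Σ[ σ ∈ Strategy N₀ ] Winning N₀ σ)

-- (⇒) Given a faithful representation θ of 𝒮 by relations on X, ∃ keeps an injective
-- assignment of her nodes to points of X and labels (x, y) with ⊤ by exactly the elements whose
-- relation contains the assigned pair, ⊥ by the others. Consistency is inherited from θ, and every
-- move of ∀ is answered by reading off a (classically chosen) witness point in X. A pair a ≠ b is
-- separated by some pair of points, which gives the initial network.
-- (⇐) For a ≠ b, let ∀ play against a winning strategy of ∃ a fair play in which, by countability,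
-- every possible move is scheduled infinitely often. The ⊤-labels accumulated along the play form
-- a saturated labelling of ℕ, which is a representation of 𝒮 by relations on ℕ separating a from
-- b; the disjoint union of these representations over all such pairs is faithful.
module Submission where

open import Defs
open import Axiom.ExcludedMiddle using (ExcludedMiddle)
open import Level using (0ℓ; lift; lower) renaming (suc to lsuc)
open import Function.Bundles using (_⇔_; mk⇔; Equivalence)
open import Data.Nat
  using (ℕ; zero; suc; _<_; _≤_; _+_; _≟_; _⊔_; s≤s; z≤n; _≤′_; ≤′-reflexive; ≤′-step)
open import Data.Nat.Properties
open import Data.Maybe using (Maybe; just; nothing; zip)
open import Data.Product using (Σ; Σ-syntax; ∃-syntax; _×_; _,_; proj₁; proj₂)
open import Data.Sum using (_⊎_; inj₁; inj₂; map₂)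
open import Data.Empty using (⊥-elim)
open import Function using (_∘_)
open import Relation.Nullary using (¬_; Dec; yes; no)
open import Relation.Nullary.Decidable using (map′; decidable-stable)
open import Relation.Binary.PropositionalEquality

module Classical (em : ExcludedMiddle (lsuc 0ℓ)) where

  decide : (P : Set) → Dec P
  decide P = map′ lower lift em

  by-contradiction : {P : Set} → ¬ ¬ P → P
  by-contradiction = decidable-stable (decide _)

cantor-step : ℕ × ℕ → ℕ × ℕ
cantor-step (zero , j) = suc j , 0
cantor-step (suc i , j) = i , suc j

unpair : ℕ → ℕ × ℕ
unpair zero = 0 , 0
unpair (suc k) = cantor-step (unpair k)

unpair-sum≤ : ∀ k → proj₁ (unpair k) + proj₂ (unpair k) ≤ k
unpair-sum≤ zero = z≤n
unpair-sum≤ (suc k) with unpair k | unpair-sum≤ k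
... | zero , j | i+j≤k = s≤s (subst (_≤ k) (sym (+-identityʳ j)) i+j≤k)
... | suc i , j | i+j≤k = subst (_≤ suc k) (sym (+-suc i j)) (m≤n⇒m≤1+n i+j≤k)

unpair-surjective : ∀ i j → ∃[ k ] unpair k ≡ (i , j)
unpair-surjective i j = on-diagonal (i + j) i j refl
  where
  on-diagonal : ∀ s i j → i + j ≡ s → ∃[ k ] unpair k ≡ (i , j)
  on-diagonal s zero zero _ = 0 , refl
  on-diagonal s i (suc j) i+j≡s
    with k , eq ← on-diagonal s (suc i) j (trans (sym (+-suc i j)) i+j≡s)
    = suc k , cong cantor-step eq
  on-diagonal (suc s) (suc i) zero i+j≡s
    with k , eq ← on-diagonal s zero i (trans (sym (+-identityʳ i)) (suc-injective i+j≡s))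
    = suc k , cong cantor-step eq

-- Since proj₁ (unpair k) ≤ k, every value of e recurs at arbitrarily late times.
repeatedly : {A : Set} → (ℕ → A) → ℕ → A
repeatedly e k = e (proj₂ (unpair k))

repeatedly-hits : {A : Set} (e : ℕ → A) {a : A} → ∃[ n ] e n ≡ a →
                  ∀ s → ∃[ k ] s ≤ k × repeatedly e k ≡ a
repeatedly-hits e (n , en≡a) s with k , eq ← unpair-surjective s n =
  k , ≤-trans (m≤m+n s n) (subst (λ p → proj₁ p + proj₂ p ≤ k) eq (unpair-sum≤ k))
    , trans (cong (e ∘ proj₂) eq) en≡a

Enumeration : Set → Set
Enumeration A = Σ[ e ∈ (ℕ → Maybe A) ] (∀ a → ∃[ n ] e n ≡ just a)

ℕ-enumeration : Enumeration ℕ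
ℕ-enumeration = just , λ n → n , refl

×-enumeration : {A B : Set} → Enumeration A → Enumeration B → Enumeration (A × B)
×-enumeration (e , e-onto) (f , f-onto) = enum , onto
  where
  enum : ℕ → Maybe _
  enum k = zip (e (proj₁ (unpair k))) (f (proj₂ (unpair k)))
  onto : ∀ ab → ∃[ k ] enum k ≡ just ab
  onto (a , b)
    with i , ei ← e-onto a with j , fj ← f-onto b with k , eq ← unpair-surjective i j =
    k , trans (cong (λ p → zip (e (proj₁ p)) (f (proj₂ p))) eq) (cong₂ zip ei fj)

module _ (em : ExcludedMiddle (lsuc 0ℓ)) where
  open Classical em

  injection-enumeration : {A : Set} (f : A → ℕ) → (∀ a b → f a ≡ f b → a ≡ b) → Enumeration A
  injection-enumeration {A} f f-injective = enum , onto
    where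
    preimage : ∀ n → Dec (∃[ a ] f a ≡ n) → Maybe A
    preimage n (yes (a , _)) = just a
    preimage n (no _) = nothing
    enum : ℕ → Maybe A
    enum n = preimage n (decide _)
    onto : ∀ a → ∃[ n ] enum n ≡ just a
    onto a = f a , preimage-f (decide _)
      where
      preimage-f : ∀ d → preimage (f a) d ≡ just a
      preimage-f (yes (b , fb≡fa)) = cong just (f-injective b a fb≡fa)
      preimage-f (no ∄) = ⊥-elim (∄ (a , refl))

module Networks (S : DRStar) where
  open DRStar S
  open Game S

  variable
    N N' N'' : Network
    x y : ℕ
    a : Carrier

  extends-refl : Extends N N
  extends-refl = (λ _ p → p) , (λ _ _ _ p → p) , (λ _ _ _ p → p)

  extends-trans : Extends N N' → Extends N' N'' → Extends N N''
  extends-trans (n , t , b) (n' , t' , b') =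
    (λ x p → n' x (n x p)) , (λ x y c p → t' x y c (t x y c p)) , (λ x y c p → b' x y c (b x y c p))

  extends-top : Extends N N' → ∀ {x y c} → InTop N x y c → InTop N' x y c
  extends-top (_ , t , _) = t _ _ _

  extends-bot : Extends N N' → ∀ {x y c} → InBot N x y c → InBot N' x y c
  extends-bot (_ , _ , b) = b _ _ _

  addTop-here : ∀ N x y a → InTop (addTop N x y a) x y a
  addTop-here _ _ _ _ = inj₂ (inj₁ refl) , inj₂ (inj₂ refl) , inj₂ (refl , refl , refl)

  addBot-here : ∀ N x y a → InBot (addBot N x y a) x y a
  addBot-here _ _ _ _ = inj₂ (inj₁ refl) , inj₂ (inj₂ refl) , inj₂ (refl , refl , refl)

  addTop-extends : Extends N (addTop N x y a)
  addTop-extends =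
    (λ _ → inj₁) , (λ _ _ _ (px , py , t) → inj₁ px , inj₁ py , inj₁ (px , py , t))
                 , (λ _ _ _ (px , py , b) → inj₁ px , inj₁ py , (px , py , b))

  addBot-extends : Extends N (addBot N x y a)
  addBot-extends =
    (λ _ → inj₁) , (λ _ _ _ (px , py , t) → inj₁ px , inj₁ py , (px , py , t))
                 , (λ _ _ _ (px , py , b) → inj₁ px , inj₁ py , inj₁ (px , py , b))

  addTop-there : ∀ N x y a {u v c} → InTop N u v c → InTop (addTop N x y a) u v c
  addTop-there _ _ _ _ (pu , pv , t) = inj₁ pu , inj₁ pv , inj₁ (pu , pv , t)

  addBot-there : ∀ N x y a {u v c} → InTop N u v c → InTop (addBot N x y a) u v c
  addBot-there _ _ _ _ (pu , pv , t) = inj₁ pu , inj₁ pv , (pu , pv , t)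

  addTop-least : Extends N N' → InTop N' x y a → Extends (addTop N x y a) N'
  addTop-least (n , t , b) xya@(px , py , _) =
    (λ { v (inj₁ p) → n v p ; v (inj₂ (inj₁ refl)) → px ; v (inj₂ (inj₂ refl)) → py })
    , (λ { u v c (_ , _ , inj₁ p) → t u v c p ; u v c (_ , _ , inj₂ (refl , refl , refl)) → xya })
    , (λ u v c (_ , _ , p) → b u v c p)

  addBot-least : Extends N N' → InBot N' x y a → Extends (addBot N x y a) N'
  addBot-least (n , t , b) xya@(px , py , _) =
    (λ { v (inj₁ p) → n v p ; v (inj₂ (inj₁ refl)) → px ; v (inj₂ (inj₂ refl)) → py })
    , (λ u v c (_ , _ , p) → t u v c p)
    , (λ { u v c (_ , _ , inj₁ p) → b u v c p ; u v c (_ , _ , inj₂ (refl , refl , refl)) → xya })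

  Nref-top : ∀ u v → InTop (Nref u v) 0 0 u
  Nref-top _ _ = refl , refl , refl , refl , refl

  Nref-bot : ∀ u v → InBot (Nref u v) 0 0 v
  Nref-bot _ _ = refl , refl , refl , refl , refl

  Nnref-top : ∀ u v → InTop (Nnref u v) 0 1 u
  Nnref-top _ _ = inj₁ refl , inj₂ refl , refl , refl , refl

  Nnref-bot : ∀ u v → InBot (Nnref u v) 0 1 v
  Nnref-bot _ _ = inj₁ refl , inj₂ refl , refl , refl , refl

  Initial : Carrier → Carrier → Network → Set
  Initial a b N₀ = Extends (Nref a b) N₀ ⊎ Extends (Nnref a b) N₀
                 ⊎ Extends (Nref b a) N₀ ⊎ Extends (Nnref b a) N₀

  Response⇒Extends : (m : Move N) → Response N m N' → Extends N N'
  Response⇒Extends (witness _ _ _ _ _) (_ , E) = extends-trans (extends-trans addTop-extends addTop-extends) E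
  Response⇒Extends (compDom _ _ _ _ _ _ _) E = extends-trans addTop-extends E
  Response⇒Extends (comp _ _ _ _ _ _ _) (inj₁ E) = extends-trans addTop-extends E
  Response⇒Extends (comp _ _ _ _ _ _ _) (inj₂ (_ , E)) =
    extends-trans (extends-trans addTop-extends addBot-extends) E
  Response⇒Extends (domRange _ _ _ _) E = extends-trans (extends-trans addTop-extends addTop-extends) E
  Response⇒Extends (domain _ _ _) (_ , E) = extends-trans addTop-extends E
  Response⇒Extends (range _ _ _) (_ , E) = extends-trans addTop-extends E

module Labellings (S : DRStar) where
  open DRStar S
  open Equivalence

  Homomorphic : {X : Set} → (Carrier → BRel X) → Set
  Homomorphic θ = (∀ a → θ (D a) ≐ Dʳ (θ a))
                × (∀ a → θ (R a) ≐ Rʳ (θ a))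
                × (∀ a b → θ (a * b) ≐ (θ a ⊛ θ b))

  -- L x y a: the edge x → y carries the ⊤-label a.
  Labelling : Set₁
  Labelling = ℕ → ℕ → Carrier → Set

  record Saturated (L : Labelling) : Set where
    field
      D-loop     : ∀ {x y t} → L x y (D t) → x ≡ y
      R-loop     : ∀ {x y t} → L x y (R t) → x ≡ y
      *-witness  : ∀ {x z a b} → L x z (a * b) → ∃[ y ] L x y a × L y z b
      *-domain   : ∀ {x y z a b} → L x y a → L x z (a * b) → L y y (D b)
      *-closed   : ∀ {x y z a b} → L x y a → L y z b → (∀ w → L x w a → L w w (D b)) →
                   L x z (a * b)
      D-R-closed : ∀ {x y a} → L x y a → L x x (D a) × L y y (R a)
      D-witness  : ∀ {x a} → L x x (D a) → ∃[ y ] L x y a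
      R-witness  : ∀ {y a} → L y y (R a) → ∃[ x ] L x y a

  relations : Labelling → Carrier → BRel ℕ
  relations L c x y = L x y c

  saturated-homomorphic : {L : Labelling} → Saturated L → Homomorphic (relations L)
  saturated-homomorphic {L} sat = hom-D , hom-R , hom-*
    where
    open Saturated sat
    loop-D : ∀ {b w} → Dʳ (relations L b) w w → L w w (D b)
    loop-D (_ , _ , t) = proj₁ (D-R-closed t)

    hom-D : ∀ a → relations L (D a) ≐ Dʳ (relations L a)
    hom-D a x y = mk⇔ (λ t → D-loop t , D-witness (subst (λ y → L x y (D a)) (sym (D-loop t)) t))
                      (λ { (refl , _ , t) → proj₁ (D-R-closed t) })

    hom-R : ∀ a → relations L (R a) ≐ Rʳ (relations L a)
    hom-R a x y = mk⇔ (λ t → R-loop t , R-witness (subst (λ y → L x y (R a)) (sym (R-loop t)) t))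
                      (λ { (refl , _ , t) → proj₂ (D-R-closed t) })

    hom-* : ∀ a b → relations L (a * b) ≐ (relations L a ⊛ relations L b)
    hom-* a b x z = mk⇔
      (λ t → *-witness t , λ w tw → refl , D-witness (*-domain tw t))
      (λ ((_ , ta , tb) , dom) → *-closed ta tb (λ w tw → loop-D (dom w tw)))

  union : {I Y : Set} → (I → Carrier → BRel Y) → Carrier → BRel (I × Y)
  union θ c (i , x) (j , y) = i ≡ j × θ i c x y

  module _ {I Y : Set} {θ : I → Carrier → BRel Y} (hom : ∀ i → Homomorphic (θ i)) where
    private
      hD : ∀ i a → θ i (D a) ≐ Dʳ (θ i a)
      hD i = proj₁ (hom i)
      hR : ∀ i a → θ i (R a) ≐ Rʳ (θ i a)
      hR i = proj₁ (proj₂ (hom i))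
      h* : ∀ i a b → θ i (a * b) ≐ (θ i a ⊛ θ i b)
      h* i = proj₂ (proj₂ (hom i))

    union-D : ∀ a → union θ (D a) ≐ Dʳ (union θ a)
    union-D a (i , x) _ = mk⇔ to′ from′
      where
      to′ : ∀ {v} → union θ (D a) (i , x) v → Dʳ (union θ a) (i , x) v
      to′ {_ , y} (refl , t) with refl , w , tw ← to (hD i a x y) t = refl , (i , w) , refl , tw
      from′ : ∀ {v} → Dʳ (union θ a) (i , x) v → union θ (D a) (i , x) v
      from′ (refl , (_ , w) , refl , tw) = refl , from (hD i a x x) (refl , w , tw)

    union-R : ∀ a → union θ (R a) ≐ Rʳ (union θ a)
    union-R a (i , x) _ = mk⇔ to′ from′
      where
      to′ : ∀ {v} → union θ (R a) (i , x) v → Rʳ (union θ a) (i , x) v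
      to′ {_ , y} (refl , t) with refl , w , tw ← to (hR i a x y) t = refl , (i , w) , refl , tw
      from′ : ∀ {v} → Rʳ (union θ a) (i , x) v → union θ (R a) (i , x) v
      from′ (refl , (_ , w) , refl , tw) = refl , from (hR i a x x) (refl , w , tw)

    union-* : ∀ a b → union θ (a * b) ≐ (union θ a ⊛ union θ b)
    union-* a b (i , x) _ = mk⇔ to′ from′
      where
      to′ : ∀ {v} → union θ (a * b) (i , x) v → (union θ a ⊛ union θ b) (i , x) v
      to′ {_ , z} (refl , t) with (y , ta , tb) , dom ← to (h* i a b x z) t =
        ((i , y) , (refl , ta) , (refl , tb)) , λ { (_ , w) (refl , tw) → dom-in-union (dom w tw) }
        where
        dom-in-union : ∀ {w} → Dʳ (θ i b) w w → Dʳ (union θ b) (i , w) (i , w)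
        dom-in-union (refl , v , tv) = refl , (i , v) , refl , tv
      from′ : ∀ {v} → (union θ a ⊛ union θ b) (i , x) v → union θ (a * b) (i , x) v
      from′ {_ , z} (((_ , y) , (refl , ta) , (refl , tb)) , dom) =
        refl , from (h* i a b x z) ((y , ta , tb) , λ w tw → dom-in-component (dom (i , w) (refl , tw)))
        where
        dom-in-component : ∀ {w} → Dʳ (union θ b) (i , w) (i , w) → Dʳ (θ i b) w w
        dom-in-component (_ , (_ , v) , refl , tv) = refl , v , tv

    union-homomorphic : Homomorphic (union θ)
    union-homomorphic = union-D , union-R , union-*

  module _ (em : ExcludedMiddle (lsuc 0ℓ)) where
    open Classical em

    union-injective : {I Y : Set} {θ : I → Carrier → BRel Y} →
                      (∀ a b → ¬ a ≡ b → ∃[ i ] ¬ (θ i a ≐ θ i b)) →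
                      ∀ a b → union θ a ≐ union θ b → a ≡ b
    union-injective {θ = θ} separated a b a≐b = by-contradiction λ a≢b →
      let i , ¬a≐b = separated a b a≢b in
      ¬a≐b λ x y → mk⇔ (λ t → proj₂ (to (a≐b (i , x) (i , y)) (refl , t)))
                       (λ t → proj₂ (from (a≐b (i , x) (i , y)) (refl , t)))

module StrategyToRepresentation (em : ExcludedMiddle (lsuc 0ℓ)) (S : DRStar)
                                (carriers : Enumeration (DRStar.Carrier S)) where
  open DRStar S
  open Game S
  open Networks S
  open Labellings S
  open Classical em

  data MoveKind : Set where
    witness compDom comp domRange domain range : MoveKind

  MoveKind-enumeration : Enumeration MoveKind
  MoveKind-enumeration = enum , onto
    where
    enum : ℕ → Maybe MoveKind
    enum 0 = just witness
    enum 1 = just compDom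
    enum 2 = just comp
    enum 3 = just domRange
    enum 4 = just domain
    enum 5 = just range
    enum _ = nothing
    onto : ∀ k → ∃[ n ] enum n ≡ just k
    onto witness = 0 , refl
    onto compDom = 1 , refl
    onto comp = 2 , refl
    onto domRange = 3 , refl
    onto domain = 4 , refl
    onto range = 5 , refl

  -- A move of ∀ stripped of its side condition; each kind ignores some coordinates.
  Candidate : Set
  Candidate = MoveKind × ℕ × ℕ × ℕ × Carrier × Carrier

  candidates : Enumeration Candidate
  candidates = ×-enumeration MoveKind-enumeration
                 (×-enumeration ℕ-enumeration (×-enumeration ℕ-enumeration
                   (×-enumeration ℕ-enumeration (×-enumeration carriers carriers))))

  Legal : Candidate → Network → Set
  Legal (witness  , x , y , z , a , b) N = InTop N x z (a * b)
  Legal (compDom  , x , y , z , a , b) N = InTop N x y a × InTop N x z (a * b)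
  Legal (comp     , x , y , z , a , b) N = InTop N x y a × InTop N y z b
  Legal (domRange , x , y , z , a , b) N = InTop N x y a
  Legal (domain   , x , y , z , a , b) N = InTop N x x (D a)
  Legal (range    , x , y , z , a , b) N = InTop N y y (R a)

  toMove : {N : Network} (c : Candidate) → Legal c N → Move N
  toMove (witness  , x , y , z , a , b) l = witness x z a b l
  toMove (compDom  , x , y , z , a , b) (l , l') = compDom x y z a b l l'
  toMove (comp     , x , y , z , a , b) (l , l') = comp x y z a b l l'
  toMove (domRange , x , y , z , a , b) l = domRange x y a l
  toMove (domain   , x , y , z , a , b) l = domain x a l
  toMove (range    , x , y , z , a , b) l = range y a l

  Legal-mono : {N N' : Network} (c : Candidate) → Extends N N' → Legal c N → Legal c N'
  Legal-mono (witness  , _) E l = extends-top E l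
  Legal-mono (compDom  , _) E (l , l') = extends-top E l , extends-top E l'
  Legal-mono (comp     , _) E (l , l') = extends-top E l , extends-top E l'
  Legal-mono (domRange , _) E l = extends-top E l
  Legal-mono (domain   , _) E l = extends-top E l
  Legal-mono (range    , _) E l = extends-top E l

  Effect : Candidate → Network → Set
  Effect (witness  , x , y , z , a , b) N = ∃[ y ] InTop N x y a × InTop N y z b
  Effect (compDom  , x , y , z , a , b) N = InTop N y y (D b)
  Effect (comp     , x , y , z , a , b) N = InTop N x z (a * b) ⊎ ∃[ w ] InTop N x w a × InBot N w w (D b)
  Effect (domRange , x , y , z , a , b) N = InTop N x x (D a) × InTop N y y (R a)
  Effect (domain   , x , y , z , a , b) N = ∃[ y ] InTop N x y a
  Effect (range    , x , y , z , a , b) N = ∃[ x ] InTop N x y a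

  response-effect : {N N' : Network} (c : Candidate) (l : Legal c N) →
                    Response N (toMove c l) N' → Effect c N'
  response-effect {N} (witness , x , _ , z , a , b) _ (y , _ , ⊆ , _) =
    y , ⊆ x y a (addTop-there (addTop N x y a) y z b (addTop-here N x y a))
      , ⊆ y z b (addTop-here (addTop N x y a) y z b)
  response-effect {N} (compDom , x , y , z , a , b) _ (_ , ⊆ , _) = ⊆ y y (D b) (addTop-here N y y (D b))
  response-effect {N} (comp , x , y , z , a , b) _ (inj₁ (_ , ⊆ , _)) =
    inj₁ (⊆ x z (a * b) (addTop-here N x z (a * b)))
  response-effect {N} (comp , x , y , z , a , b) _ (inj₂ (w , _ , ⊆ , ⊆⊥)) =
    inj₂ (w , ⊆ x w a (addBot-there (addTop N x w a) w w (D b) (addTop-here N x w a))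
            , ⊆⊥ w w (D b) (addBot-here (addTop N x w a) w w (D b)))
  response-effect {N} (domRange , x , y , z , a , b) _ (_ , ⊆ , _) =
    ⊆ x x (D a) (addTop-there (addTop N x x (D a)) y y (R a) (addTop-here N x x (D a)))
    , ⊆ y y (R a) (addTop-here (addTop N x x (D a)) y y (R a))
  response-effect {N} (domain , x , y , z , a , b) _ (y' , _ , ⊆ , _) = y' , ⊆ x y' a (addTop-here N x y' a)
  response-effect {N} (range , x , y , z , a , b) _ (x' , _ , ⊆ , _) = x' , ⊆ x' y a (addTop-here N x' y a)

  attempt : {N : Network} (c : Candidate) → Move N → Dec (Legal c N) → Move N
  attempt c _ (yes l) = toMove c l
  attempt c m (no _) = m

  attempt-effect : {N N' : Network} (c : Candidate) → Legal c N → (m : Move N) (d : Dec (Legal c N)) →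
                   Response N (attempt c m d) N' → Effect c N'
  attempt-effect c _ _ (yes l) = response-effect c l
  attempt-effect c l _ (no ¬l) _ = ⊥-elim (¬l l)

  -- ∀ schedules every candidate infinitely often, playing the fixed legal move c₀ whenever the
  -- scheduled candidate is not (yet) legal.
  module FairPlay (N₀ : Network) (N₀-consistent : Consistent N₀)
                  (σ : Strategy N₀) (σ-wins : Winning N₀ σ)
                  (c₀ : Candidate) (c₀-legal : Legal c₀ N₀) where

    record Position : Set₁ where
      constructor position
      field
        network  : Network
        history  : Hist N₀ network
        conforms : Conform σ history
        extends  : Extends N₀ network
    open Position

    schedule : ℕ → Maybe Candidate
    schedule = repeatedly (proj₁ candidates)

    scheduled : Maybe Candidate → (p : Position) → Move (network p)
    scheduled nothing p = toMove c₀ (Legal-mono c₀ (extends p) c₀-legal)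
    scheduled (just c) p = attempt c (scheduled nothing p) (decide _)

    advance : Maybe Candidate → Position → Position
    advance mc p = position (σ (history p) m) (step (history p) m _) (step (conforms p) m)
                     (extends-trans (extends p) (Response⇒Extends m (proj₁ (σ-wins _ (conforms p) m))))
      where
      m : Move (network p)
      m = scheduled mc p

    play : ℕ → Position
    play zero = position N₀ start start extends-refl
    play (suc k) = advance (schedule k) (play k)

    Net : ℕ → Network
    Net k = network (play k)

    round : ∀ k → Response (Net k) (scheduled (schedule k) (play k)) (Net (suc k)) × Consistent (Net (suc k))
    round k = σ-wins (history (play k)) (conforms (play k)) (scheduled (schedule k) (play k))

    Net-consistent : ∀ k → Consistent (Net k)
    Net-consistent zero = N₀-consistent
    Net-consistent (suc k) = proj₂ (round k)

    Net-mono : ∀ {s k} → s ≤ k → Extends (Net s) (Net k)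
    Net-mono = go ∘ ≤⇒≤′
      where
      go : ∀ {s k} → s ≤′ k → Extends (Net s) (Net k)
      go (≤′-reflexive refl) = extends-refl
      go (≤′-step {k} s≤k) = extends-trans (go s≤k) (Response⇒Extends _ (proj₁ (round k)))

    scheduled-effect : ∀ k c → schedule k ≡ just c → Legal c (Net k) → Effect c (Net (suc k))
    scheduled-effect k c eq l =
      attempt-effect c l _ (decide _)
        (subst (λ mc → Response (Net k) (scheduled mc (play k)) (Net (suc k))) eq (proj₁ (round k)))

    eventually : ∀ s c → Legal c (Net s) → ∃[ k ] Effect c (Net k)
    eventually s c l with k , s≤k , hit ← repeatedly-hits (proj₁ candidates) (proj₂ candidates c) s =
      suc k , scheduled-effect k c hit (Legal-mono c (Net-mono s≤k) l)

    Limit : Labelling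
    Limit x y c = ∃[ k ] InTop (Net k) x y c

    simultaneously : ∀ {x y a u v b} → Limit x y a → Limit u v b →
                     ∃[ k ] InTop (Net k) x y a × InTop (Net k) u v b
    simultaneously (s , p) (t , q) =
      s ⊔ t , extends-top (Net-mono (m≤m⊔n s t)) p , extends-top (Net-mono (m≤n⊔m s t)) q

    Limit-avoids-bot : ∀ s {x y c} → InBot (Net s) x y c → ¬ Limit x y c
    Limit-avoids-bot s b (k , t) =
      proj₁ (Net-consistent (s ⊔ k)) _ _ _ (extends-top (Net-mono (m≤n⊔m s k)) t)
                                           (extends-bot (Net-mono (m≤m⊔n s k)) b)

    Limit-saturated : Saturated Limit
    Limit-saturated = record
      { D-loop = λ {t = t} (k , p) → proj₂ (Net-consistent k) _ _ _ p (t , inj₁ refl)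
      ; R-loop = λ {t = t} (k , p) → proj₂ (Net-consistent k) _ _ _ p (t , inj₂ refl)
      ; *-witness = *-witness ; *-domain = *-domain ; *-closed = *-closed
      ; D-R-closed = D-R-closed ; D-witness = D-witness ; R-witness = R-witness }
      where
      *-witness : ∀ {x z a b} → Limit x z (a * b) → ∃[ y ] Limit x y a × Limit y z b
      *-witness {x} {z} {a} {b} (s , p) with k , y , p , q ← eventually s (witness , x , 0 , z , a , b) p =
        y , (k , p) , (k , q)

      *-domain : ∀ {x y z a b} → Limit x y a → Limit x z (a * b) → Limit y y (D b)
      *-domain {x} {y} {z} {a} {b} p q with s , p , q ← simultaneously p q =
        eventually s (compDom , x , y , z , a , b) (p , q)

      -- ∃ may refute a * b on (x, z) only by a w with a on (x, w) and D b in ⊥(w, w).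
      *-closed : ∀ {x y z a b} → Limit x y a → Limit y z b → (∀ w → Limit x w a → Limit w w (D b)) →
                 Limit x z (a * b)
      *-closed {x} {y} {z} {a} {b} p q dom
        with s , p , q ← simultaneously p q with eventually s (comp , x , y , z , a , b) (p , q)
      ... | k , inj₁ p = k , p
      ... | k , inj₂ (w , p , ¬dom) = ⊥-elim (Limit-avoids-bot k ¬dom (dom w (k , p)))

      D-R-closed : ∀ {x y a} → Limit x y a → Limit x x (D a) × Limit y y (R a)
      D-R-closed {x} {y} {a} (s , p) with k , p , q ← eventually s (domRange , x , y , 0 , a , a) p =
        (k , p) , (k , q)

      D-witness : ∀ {x a} → Limit x x (D a) → ∃[ y ] Limit x y a
      D-witness {x} {a} (s , p) with k , y , p ← eventually s (domain , x , 0 , 0 , a , a) p = y , k , p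

      R-witness : ∀ {y a} → Limit y y (R a) → ∃[ x ] Limit x y a
      R-witness {y} {a} (s , p) with k , x , p ← eventually s (range , 0 , y , 0 , a , a) p = x , k , p

  Separating : Carrier → Carrier → Network → ℕ → ℕ → Set
  Separating a b N x y = InTop N x y a × InBot N x y b ⊎ InTop N x y b × InBot N x y a

  initial-edge : ∀ {a b N₀} → Initial a b N₀ → ∃[ x ] ∃[ y ] Separating a b N₀ x y
  initial-edge {a} {b} (inj₁ (_ , ⊆ , ⊆⊥)) =
    0 , 0 , inj₁ (⊆ 0 0 a (Nref-top a b) , ⊆⊥ 0 0 b (Nref-bot a b))
  initial-edge {a} {b} (inj₂ (inj₁ (_ , ⊆ , ⊆⊥))) =
    0 , 1 , inj₁ (⊆ 0 1 a (Nnref-top a b) , ⊆⊥ 0 1 b (Nnref-bot a b))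
  initial-edge {a} {b} (inj₂ (inj₂ (inj₁ (_ , ⊆ , ⊆⊥)))) =
    0 , 0 , inj₂ (⊆ 0 0 b (Nref-top b a) , ⊆⊥ 0 0 a (Nref-bot b a))
  initial-edge {a} {b} (inj₂ (inj₂ (inj₂ (_ , ⊆ , ⊆⊥)))) =
    0 , 1 , inj₂ (⊆ 0 1 b (Nnref-top b a) , ⊆⊥ 0 1 a (Nnref-bot b a))

  separating-labelling : ∃WinsΓω → ∀ a b → ¬ a ≡ b →
                         Σ[ L ∈ Labelling ] Saturated L × ¬ (relations L a ≐ relations L b)
  separating-labelling win a b a≢b
    with N₀ , init , N₀-consistent , σ , σ-wins ← win a b a≢b with x , y , edge ← initial-edge init =
    Limit , Limit-saturated , separated edge
    where
    seed : Separating a b N₀ x y → ∃[ c ] Legal c N₀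
    seed (inj₁ (t , _)) = (domRange , x , y , 0 , a , a) , t
    seed (inj₂ (t , _)) = (domRange , x , y , 0 , b , b) , t
    open FairPlay N₀ N₀-consistent σ σ-wins (proj₁ (seed edge)) (proj₂ (seed edge))
    separated : Separating a b N₀ x y → ¬ (relations Limit a ≐ relations Limit b)
    separated (inj₁ (t , f)) a≐b = Limit-avoids-bot 0 f (Equivalence.to (a≐b x y) (0 , t))
    separated (inj₂ (t , f)) a≐b = Limit-avoids-bot 0 f (Equivalence.from (a≐b x y) (0 , t))

  DistinctPair : Set
  DistinctPair = Σ[ a ∈ Carrier ] Σ[ b ∈ Carrier ] ¬ a ≡ b

  winning⇒representable : ∃WinsΓω → Representable S
  winning⇒representable win =
    (DistinctPair × ℕ) , union θ
    , union-injective em (λ a b a≢b → (a , b , a≢b) , separates (a , b , a≢b))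
    , union-homomorphic (λ i → saturated-homomorphic (saturated i))
    where
    labelling : ((a , b , _) : DistinctPair) →
                Σ[ L ∈ Labelling ] Saturated L × ¬ (relations L a ≐ relations L b)
    labelling (a , b , a≢b) = separating-labelling win a b a≢b
    θ : DistinctPair → Carrier → BRel ℕ
    θ i = relations (proj₁ (labelling i))
    saturated : ∀ i → Saturated (proj₁ (labelling i))
    saturated i = proj₁ (proj₂ (labelling i))
    separates : ∀ i → let (a , b , _) = i in ¬ (θ i a ≐ θ i b)
    separates i = proj₂ (proj₂ (labelling i))

snoc : {X : Set} → (ℕ → X) → ℕ → X → ℕ → X
snoc f n p i with i ≟ n
... | yes _ = p
... | no _ = f i

snoc-new : {X : Set} (f : ℕ → X) (n : ℕ) (p : X) → snoc f n p n ≡ p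
snoc-new f n p with n ≟ n
... | yes _ = refl
... | no n≢n = ⊥-elim (n≢n refl)

snoc-old : {X : Set} (f : ℕ → X) {n : ℕ} (p : X) {i : ℕ} → i < n → snoc f n p i ≡ f i
snoc-old f {n} p {i} i<n with i ≟ n
... | yes refl = ⊥-elim (<-irrefl refl i<n)
... | no _ = refl

snoc-injective : {X : Set} {f : ℕ → X} {n : ℕ} {p : X} →
                 (∀ {i j} → i < n → j < n → f i ≡ f j → i ≡ j) → ¬ (∃[ i ] i < n × f i ≡ p) →
                 ∀ {i j} → i < suc n → j < suc n → snoc f n p i ≡ snoc f n p j → i ≡ j
snoc-injective {f = f} {n} {p} f-injective p∉f {i} {j} i<1+n j<1+n eq
  with m<1+n⇒m<n∨m≡n i<1+n | m<1+n⇒m<n∨m≡n j<1+n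
... | inj₁ i<n | inj₁ j<n =
  f-injective i<n j<n (trans (sym (snoc-old f p i<n)) (trans eq (snoc-old f p j<n)))
... | inj₁ i<n | inj₂ refl =
  ⊥-elim (p∉f (i , i<n , trans (sym (snoc-old f p i<n)) (trans eq (snoc-new f n p))))
... | inj₂ refl | inj₁ j<n =
  ⊥-elim (p∉f (j , j<n , trans (sym (snoc-old f p j<n)) (trans (sym eq) (snoc-new f n p))))
... | inj₂ refl | inj₂ refl = refl

module RepresentationToStrategy (em : ExcludedMiddle (lsuc 0ℓ)) (S : DRStar)
                                {X : Set} (θ : DRStar.Carrier S → BRel X)
                                (hom : Labellings.Homomorphic S θ) where
  open DRStar S
  open Game S
  open Networks S
  open Classical em
  open Equivalence

  private
    hom-D : ∀ a → θ (D a) ≐ Dʳ (θ a)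
    hom-D = proj₁ hom
    hom-R : ∀ a → θ (R a) ≐ Rʳ (θ a)
    hom-R = proj₁ (proj₂ hom)
    hom-* : ∀ a b → θ (a * b) ≐ (θ a ⊛ θ b)
    hom-* = proj₂ (proj₂ hom)

  -- Nodes 0, …, size - 1 of ∃'s network, placed injectively in the representation.
  record Assignment : Set where
    field
      size            : ℕ
      point           : ℕ → X
      point-injective : ∀ {i j} → i < size → j < size → point i ≡ point j → i ≡ j
  open Assignment

  induced : Assignment → Network
  induced α = record
    { node = _< size α
    ; top  = λ u v c → θ c (point α u) (point α v)
    ; bot  = λ u v c → ¬ θ c (point α u) (point α v) }

  -- Consistency (ii) holds because D and R are represented by subidentities.
  induced-consistent : ∀ α → Consistent (induced α)
  induced-consistent α =
      (λ _ _ _ (_ , _ , t) (_ , _ , ¬t) → ¬t t)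
    , λ { x y _ (px , py , t) (s , inj₁ refl) → point-injective α px py (proj₁ (to (hom-D s _ _) t))
        ; x y _ (px , py , t) (s , inj₂ refl) → point-injective α px py (proj₁ (to (hom-R s _ _) t)) }

  record _⊑_ (α β : Assignment) : Set where
    constructor ⊑⁺
    field
      size-mono  : size α ≤ size β
      point-kept : ∀ {i} → i < size α → point β i ≡ point α i
  open _⊑_

  ⊑-refl : ∀ {α} → α ⊑ α
  ⊑-refl = ⊑⁺ ≤-refl (λ _ → refl)

  ⊑-node : ∀ {α β i} → α ⊑ β → i < size α → i < size β
  ⊑-node α⊑β i< = <-≤-trans i< (size-mono α⊑β)

  ⊑-left : ∀ {α β i c q} → α ⊑ β → i < size α → θ c (point α i) q → θ c (point β i) q
  ⊑-left {c = c} {q} α⊑β i< = subst (λ p → θ c p q) (sym (point-kept α⊑β i<))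

  ⊑-right : ∀ {α β i c q} → α ⊑ β → i < size α → θ c q (point α i) → θ c q (point β i)
  ⊑-right {c = c} {q} α⊑β i< = subst (θ c q) (sym (point-kept α⊑β i<))

  ⊑⇒Extends : ∀ {α β} → α ⊑ β → Extends (induced α) (induced β)
  ⊑⇒Extends α⊑β =
      (λ _ → ⊑-node α⊑β)
    , (λ _ _ _ (pu , pv , t) → ⊑-node α⊑β pu , ⊑-node α⊑β pv , ⊑-left α⊑β pu (⊑-right α⊑β pv t))
    , (λ _ _ _ (pu , pv , ¬t) → ⊑-node α⊑β pu , ⊑-node α⊑β pv ,
                                λ t → ¬t (subst₂ (θ _) (point-kept α⊑β pu) (point-kept α⊑β pv) t))

  Placed : Assignment → (X → Set) → Assignment × ℕ → Set
  Placed α P (β , y) = α ⊑ β × y < size β × P (point β y)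

  Occurs : Assignment → X → Set
  Occurs α p = ∃[ i ] i < size α × point α i ≡ p

  insert′ : ∀ α p → Dec (Occurs α p) → Assignment × ℕ
  insert′ α p (yes (i , _)) = α , i
  insert′ α p (no p∉α) =
    record { size = suc (size α) ; point = snoc (point α) (size α) p
           ; point-injective = snoc-injective (point-injective α) p∉α }
    , size α

  insert′-placed : ∀ α p d → Placed α (_≡ p) (insert′ α p d)
  insert′-placed α p (yes (i , i< , eq)) = ⊑-refl , i< , eq
  insert′-placed α p (no _) =
    ⊑⁺ (n≤1+n _) (snoc-old (point α) p) , ≤-refl , snoc-new (point α) (size α) p

  -- Classically choose a point with property P and give it a node (reusing its node if it has one);
  -- if there is no such point, nothing changes.
  extendBy′ : ∀ α (P : X → Set) → Dec (Σ X P) → Assignment × ℕ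
  extendBy′ α P (yes (p , _)) = insert′ α p (decide _)
  extendBy′ α P (no _) = α , 0

  extendBy : Assignment → (X → Set) → Assignment
  extendBy α P = proj₁ (extendBy′ α P (decide _))

  extendBy′-⊑ : ∀ α P d → α ⊑ proj₁ (extendBy′ α P d)
  extendBy′-⊑ α P (yes (p , _)) = proj₁ (insert′-placed α p (decide _))
  extendBy′-⊑ α P (no _) = ⊑-refl

  extendBy′-placed : ∀ α P d → Σ X P → Placed α P (extendBy′ α P d)
  extendBy′-placed α P (yes (p , Pp)) _ with α⊑β , y< , y↦p ← insert′-placed α p (decide _) =
    α⊑β , y< , subst P (sym y↦p) Pp
  extendBy′-placed α P (no ∄) w = ⊥-elim (∄ w)

  extendBy-⊑ : ∀ α P → α ⊑ extendBy α P
  extendBy-⊑ α P = extendBy′-⊑ α P (decide _)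

  extendBy-placed : ∀ α P → Σ X P → ∃[ y ] Placed α P (extendBy α P , y)
  extendBy-placed α P w = _ , extendBy′-placed α P (decide _) w

  update : ∀ {N} → Assignment → Move N → Assignment
  update α (witness x z a b _) = extendBy α (λ q → θ a (point α x) q × θ b q (point α z))
  update α (compDom _ _ _ _ _ _ _) = α
  update α (comp x _ _ a b _ _) = extendBy α (λ q → θ a (point α x) q × ¬ θ (D b) q q)
  update α (domRange _ _ _ _) = α
  update α (domain x a _) = extendBy α (θ a (point α x))
  update α (range y a _) = extendBy α (λ q → θ a q (point α y))

  respond-comp : ∀ α x y z a b (xya : InTop (induced α) x y a) (yzb : InTop (induced α) y z b) →
                 let P = λ q → θ a (point α x) q × ¬ θ (D b) q q in Dec (Σ X P) →
                 Response (induced α) (comp x y z a b xya yzb) (induced (extendBy α P))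
  respond-comp α x y z a b (px , py , ta) (_ , pz , tb) (yes w)
    with w' , α⊑β , w< , ta' , ¬dom ← extendBy-placed α _ w =
    inj₂ (w' , addBot-least (addTop-least (⊑⇒Extends α⊑β) (⊑-node α⊑β px , w< , ⊑-left α⊑β px ta'))
                            (w< , w< , ¬dom))
  -- Classically, if no a-successor of x lies outside the domain of b, then a * b holds on (x, z).
  respond-comp α x y z a b (px , py , ta) (_ , pz , tb) (no ∄) =
    inj₁ (addTop-least α≤β (extends-top α≤β (px , pz , composed)))
    where
    α≤β : Extends (induced α) (induced (extendBy α (λ q → θ a (point α x) q × ¬ θ (D b) q q)))
    α≤β = ⊑⇒Extends (extendBy-⊑ α _)
    composed : θ (a * b) (point α x) (point α z)
    composed = from (hom-* a b _ _)
      ((_ , ta , tb) , λ q aq → to (hom-D b q q) (by-contradiction λ ¬dom → ∄ (q , aq , ¬dom)))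

  respond : ∀ α (m : Move (induced α)) → Response (induced α) m (induced (update α m))
  respond α (witness x z a b (px , pz , t))
    with (q , ta , tb) , _ ← to (hom-* a b _ _) t
    with y , α⊑β , y< , ta' , tb' ←
           extendBy-placed α (λ q → θ a (point α x) q × θ b q (point α z)) (q , ta , tb) =
    y , addTop-least (addTop-least (⊑⇒Extends α⊑β) (⊑-node α⊑β px , y< , ⊑-left α⊑β px ta'))
                     (y< , ⊑-node α⊑β pz , ⊑-right α⊑β pz tb')
  respond α (compDom x y z a b (_ , py , ta) (_ , _ , tab)) =
    addTop-least extends-refl (py , py , from (hom-D b _ _) (proj₂ (to (hom-* a b _ _) tab) _ ta))
  respond α (comp x y z a b xya yzb) = respond-comp α x y z a b xya yzb (decide _)
  respond α (domRange x y a (px , py , t)) =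
    addTop-least (addTop-least extends-refl (px , px , from (hom-D a _ _) (refl , _ , t)))
                 (py , py , from (hom-R a _ _) (refl , _ , t))
  respond α (domain x a (px , _ , t))
    with refl , q , tq ← to (hom-D a _ _) t
    with y , α⊑β , y< , tq' ← extendBy-placed α (θ a (point α x)) (q , tq) =
    y , addTop-least (⊑⇒Extends α⊑β) (⊑-node α⊑β px , y< , ⊑-left α⊑β px tq')
  respond α (range y a (py , _ , t))
    with refl , q , tq ← to (hom-R a _ _) t
    with x , α⊑β , x< , tq' ← extendBy-placed α (λ q → θ a q (point α y)) (q , tq) =
    x , addTop-least (⊑⇒Extends α⊑β) (x< , ⊑-node α⊑β py , ⊑-right α⊑β py tq')

  module _ (α₀ : Assignment) where

    assignment : ∀ {N} → Hist (induced α₀) N → Assignment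
    assignment start = α₀
    assignment (step h m _) = update (assignment h) m

    strategy : Strategy (induced α₀)
    strategy h m = induced (update (assignment h) m)

    strategy-wins : Winning (induced α₀) strategy
    strategy-wins .start start m = respond α₀ m , induced-consistent (update α₀ m)
    strategy-wins .(step h m′ _) (step {h = h} _ m′) m =
      let α = update (assignment h) m′ in respond α m , induced-consistent (update α m)

  singleton : X → Assignment
  singleton p = record
    { size = 1 ; point = λ _ → p ; point-injective = λ { (s≤s z≤n) (s≤s z≤n) _ → refl } }

  doubleton : (p q : X) → ¬ p ≡ q → Assignment
  doubleton p q p≢q = record { size = 2 ; point = choice ; point-injective = injective }
    where
    choice : ℕ → X
    choice zero = p
    choice (suc _) = q
    injective : ∀ {i j} → i < 2 → j < 2 → choice i ≡ choice j → i ≡ j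
    injective {0} {0} _ _ _ = refl
    injective {0} {1} _ _ p≡q = ⊥-elim (p≢q p≡q)
    injective {1} {0} _ _ q≡p = ⊥-elim (p≢q (sym q≡p))
    injective {1} {1} _ _ _ = refl
    injective {suc (suc _)} (s≤s (s≤s ())) _ _
    injective {_} {suc (suc _)} _ (s≤s (s≤s ())) _

  opening : ∀ {u v p q} → θ u p q → ¬ θ v p q →
            Σ[ α ∈ Assignment ] (Extends (Nref u v) (induced α) ⊎ Extends (Nnref u v) (induced α))
  opening {p = p} {q} tu ¬tv with decide (p ≡ q)
  ... | yes refl = singleton p , inj₁
    ( (λ { _ refl → s≤s z≤n })
    , (λ { _ _ _ (refl , refl , refl , refl , refl) → s≤s z≤n , s≤s z≤n , tu })
    , (λ { _ _ _ (refl , refl , refl , refl , refl) → s≤s z≤n , s≤s z≤n , ¬tv }))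
  ... | no p≢q = doubleton p q p≢q , inj₂
    ( (λ { _ (inj₁ refl) → s≤s z≤n ; _ (inj₂ refl) → s≤s (s≤s z≤n) })
    , (λ { _ _ _ (_ , _ , refl , refl , refl) → s≤s z≤n , s≤s (s≤s z≤n) , tu })
    , (λ { _ _ _ (_ , _ , refl , refl , refl) → s≤s z≤n , s≤s (s≤s z≤n) , ¬tv }))

  distinguishing-pair : (∀ a b → θ a ≐ θ b → a ≡ b) → ∀ {a b} → ¬ a ≡ b →
                        ∃[ p ] ∃[ q ] (θ a p q × ¬ θ b p q ⊎ θ b p q × ¬ θ a p q)
  distinguishing-pair θ-injective {a} {b} a≢b = by-contradiction λ none →
    a≢b (θ-injective a b λ p q →
      mk⇔ (λ ta → by-contradiction λ ¬tb → none (p , q , inj₁ (ta , ¬tb)))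
          (λ tb → by-contradiction λ ¬ta → none (p , q , inj₂ (tb , ¬ta))))

  winning-from : ∀ a b α → Initial a b (induced α) →
                 Σ[ N₀ ∈ Network ] (Initial a b N₀ × Consistent N₀ × Σ[ σ ∈ Strategy N₀ ] Winning N₀ σ)
  winning-from a b α init = induced α , init , induced-consistent α , strategy α , strategy-wins α

  representable⇒winning : (∀ a b → θ a ≐ θ b → a ≡ b) → ∃WinsΓω
  representable⇒winning θ-injective a b a≢b with distinguishing-pair θ-injective a≢b
  ... | _ , _ , inj₁ (ta , ¬tb) with α , init ← opening ta ¬tb =
    winning-from a b α (map₂ inj₁ init)
  ... | _ , _ , inj₂ (tb , ¬ta) with α , init ← opening tb ¬ta =
    winning-from a b α (inj₂ (inj₂ init))

lemma1 : ExcludedMiddle (lsuc 0ℓ) →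
         (S : DRStar) → Countable S →
         (Representable S ⇔ Game.∃WinsΓω S)
lemma1 em S (f , f-injective) = mk⇔
  (λ (_ , θ , θ-injective , hom) → RepresentationToStrategy.representable⇒winning em S θ hom θ-injective)
  (StrategyToRepresentation.winning⇒representable em S (injection-enumeration em f f-injective))
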